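{- For any $k$-uniform hypergraph $G(V,E)$, $\gamma(G)\ge k-1$.
   Context: A bicoloring of $G$ is a map $X:V\to\{0,1\}$; a bicoloring cover of $G$ is a set of bicolorings such that every hyperedge is non-monochromatic under at least one of them; $\chi^c(G)$ is the minimum size of a bicoloring cover. Let $C_1,\dots,C_w$ be all (labeled) bicoloring covers of $G$ of size exactly $\chi^c(G)$ (optimal covers). For an optimal cover $C_i=\{X^i_1,\dots,X^i_{\chi^c(G)}\}$, each vertex $v$ gets the color bit vector $B^i_v=(X^i_1(v),\dots,X^i_{\chi^c(G)}(v))$; this partitions $V$ into classes of vertices with identical bit vectors. Let $\gamma_i(G)$ be the size of the largest such class, and define the cover independence number $\gamma(G)=\max_{1\le i\le w}\gamma_i(G)$. -}

module Defs where

open import Data.Nat using (ℕ; zero; suc; _≤_; _⊔_)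
open import Data.Bool using (Bool)
open import Data.Bool.Properties using () renaming (_≟_ to _≟ᴮ_)
open import Data.Fin using (Fin)
open import Data.Fin.Subset using (Subset; _∈_; ∣_∣)
open import Data.Vec using (Vec; tabulate)
import Data.Vec.Properties as VP
open import Data.List using (List; foldr; map; allFin)
open import Data.Product using (Σ; ∃; ∃-syntax; _×_)
open import Relation.Nullary using (¬_; does)
open import Relation.Binary.PropositionalEquality using (_≡_)

record Hypergraph : Set where
  field
    n     : ℕ
    m     : ℕ
    edges : Fin m → Subset n
open Hypergraph public

Uniform : ℕ → Hypergraph → Set
Uniform k G = ∀ (e : Fin (m G)) → ∣ edges G e ∣ ≡ k

Bicoloring : Hypergraph → Set
Bicoloring G = Fin (n G) → Bool

NonMonochromatic : (G : Hypergraph) → Bicoloring G → Fin (m G) → Set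
NonMonochromatic G X e =
  ∃[ u ] ∃[ v ] (u ∈ edges G e × v ∈ edges G e × ¬ (X u ≡ X v))

Cover : Hypergraph → ℕ → Set
Cover G c = Fin c → Bicoloring G

IsCover : (G : Hypergraph) (c : ℕ) → Cover G c → Set
IsCover G c C = ∀ (e : Fin (m G)) → ∃[ j ] NonMonochromatic G (C j) e

IsOptimalCover : (G : Hypergraph) (c : ℕ) → Cover G c → Set
IsOptimalCover G c C =
  IsCover G c C × (∀ (c' : ℕ) (D : Cover G c') → IsCover G c' D → c ≤ c')

bitVector : (G : Hypergraph) (c : ℕ) → Cover G c → Fin (n G) → Vec Bool c
bitVector G c C v = tabulate (λ j → C j v)

classSize : (G : Hypergraph) (c : ℕ) → Cover G c → Fin (n G) → ℕ
classSize G c C v =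
  ∣ tabulate (λ u → does (VP.≡-dec _≟ᴮ_ (bitVector G c C u) (bitVector G c C v))) ∣

largestClass : (G : Hypergraph) (c : ℕ) → Cover G c → ℕ
largestClass G c C = foldr _⊔_ 0 (map (classSize G c C) (allFin (n G)))

-- g is the cover independence number γ(G): the maximum of γ_i over all
-- optimal covers (attained by some optimal cover, bounding all of them).
IsCoverIndependenceNumber : Hypergraph → ℕ → Set
IsCoverIndependenceNumber G g =
  (∃[ c ] Σ (Cover G c) λ C → IsOptimalCover G c C × largestClass G c C ≡ g)
  × (∀ (c : ℕ) (C : Cover G c) → IsOptimalCover G c C → largestClass G c C ≤ g)

module Submission where

-- Fix an optimal cover C and a vertex v, and let A be the colour
-- class of v (all vertices whose bit vector equals that of v).  If
-- |A| ≥ k - 1 we are done.  Otherwise enlarge A to a set S of exactly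
-- k - 1 vertices and repaint every vertex of S with the colours of v.
-- The repainted family is still a cover: every hyperedge e has k > |S|
-- vertices, hence a vertex u ∉ S; a separating pair of e that avoids S
-- still separates, and if the pair meets S in w, then u, lying outside
-- A, differs from v (and hence from the repainted w) in some colouring.
-- The repainted cover has the same size, so it is optimal, and its
-- colour class of v contains S; hence γ(G) ≥ |S| = k - 1.

open import Defs
open import Data.Nat using (ℕ; zero; suc; _≤_; _<_; _∸_; _⊔_; z≤n; s≤s; _≤?_)
open import Data.Nat.Properties
  using (≤-refl; ≤-trans; ≤-antisym; ≰⇒>; <⇒≤; <⇒≱; m≤m⊔n; m≤n⊔m)
open import Data.Bool using (Bool; true; if_then_else_)
open import Data.Bool.Properties using () renaming (_≟_ to _≟ᴮ_)
open import Data.Fin using (Fin; fromℕ<)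
open import Data.Fin.Properties using (¬∀⟶∃¬)
open import Data.Fin.Subset using (Subset; _∈_; _∉_; _⊆_; ∣_∣; ⊤; inside; outside)
open import Data.Fin.Subset.Properties
  using (_∈?_; p⊆q⇒∣p∣≤∣q∣; ∣p∣≤n; ∣⊤∣≡n; ⊆⊤; out⊆; in⊆in)
open import Data.Vec using ([]; _∷_; tabulate)
import Data.Vec.Properties as VP
open import Data.List using (List; foldr)
import Data.List as List
open import Data.List.Membership.Propositional using () renaming (_∈_ to _∈ᴸ_)
open import Data.List.Membership.Propositional.Properties using (∈-allFin; ∈-map⁺)
open import Data.List.Relation.Unary.Any using (here; there)
open import Data.Product using (∃-syntax; _×_; _,_; proj₁; proj₂)
open import Data.Empty using (⊥-elim)
open import Relation.Nullary using (¬_; does; yes; no)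
open import Relation.Nullary.Decidable using (dec-true; _→-dec_)
open import Relation.Binary.PropositionalEquality using (_≡_; refl; sym; trans; cong; subst)
open import Function using (id)

⊆-extend : ∀ {n} (A : Subset n) (r : ℕ) → ∣ A ∣ ≤ r → r ≤ n →
  ∃[ S ] A ⊆ S × ∣ S ∣ ≡ r
⊆-extend [] zero z≤n z≤n = [] , id , refl
⊆-extend (inside ∷ A) (suc r) (s≤s ∣A∣≤r) (s≤s r≤n)
  with S , A⊆S , ∣S∣≡r ← ⊆-extend A r ∣A∣≤r r≤n
  = inside ∷ S , in⊆in A⊆S , cong suc ∣S∣≡r
⊆-extend {suc n} (outside ∷ A) r ∣A∣≤r r≤1+n with r ≤? n
... | yes r≤n with S , A⊆S , ∣S∣≡r ← ⊆-extend A r ∣A∣≤r r≤n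
  = outside ∷ S , out⊆ A⊆S , ∣S∣≡r
-- r = n + 1: the whole vertex set is the required superset.
... | no r≰n = ⊤ , ⊆⊤ , trans (∣⊤∣≡n (suc n)) (≤-antisym (≰⇒> r≰n) r≤1+n)

larger⇒∃∉ : ∀ {n} (p q : Subset n) → ∣ q ∣ < ∣ p ∣ → ∃[ x ] x ∈ p × x ∉ q
larger⇒∃∉ {n} p q ∣q∣<∣p∣
  with x , p⊈q ← ¬∀⟶∃¬ n (λ x → x ∈ p → x ∈ q) (λ x → (x ∈? p) →-dec (x ∈? q))
                   (λ p⊆q → <⇒≱ ∣q∣<∣p∣ (p⊆q⇒∣p∣≤∣q∣ (λ {x} → p⊆q x)))
  with x ∈? p
... | yes x∈p = x , x∈p , λ x∈q → p⊈q (λ _ → x∈q)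
... | no x∉p = ⊥-elim (p⊈q (λ x∈p → ⊥-elim (x∉p x∈p)))

∈-tabulate⁺ : ∀ {n} (f : Fin n → Bool) (x : Fin n) → f x ≡ true → x ∈ tabulate f
∈-tabulate⁺ f x fx≡true = VP.lookup⇒[]= x _ (trans (VP.lookup∘tabulate f x) fx≡true)

∈⇒≤max : ∀ {x : ℕ} (xs : List ℕ) → x ∈ᴸ xs → x ≤ foldr _⊔_ 0 xs
∈⇒≤max (x List.∷ xs) (here refl) = m≤m⊔n x _
∈⇒≤max (y List.∷ xs) (there x∈xs) = ≤-trans (∈⇒≤max xs x∈xs) (m≤n⊔m y _)

module _ {G : Hypergraph} {c : ℕ} where

  colourClass : Cover G c → Fin (n G) → Subset (n G)
  colourClass C v =
    tabulate (λ u → does (VP.≡-dec _≟ᴮ_ (bitVector G c C u) (bitVector G c C v)))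

  ∈-colourClass : (C : Cover G c) {u v : Fin (n G)} →
    (∀ j → C j u ≡ C j v) → u ∈ colourClass C v
  ∈-colourClass C {u} {v} agree =
    ∈-tabulate⁺ _ u (dec-true (VP.≡-dec _≟ᴮ_ _ _) (VP.tabulate-cong agree))

  ∉-colourClass : (C : Cover G c) {u v : Fin (n G)} →
    u ∉ colourClass C v → ∃[ j ] ¬ (C j u ≡ C j v)
  ∉-colourClass C {u} {v} u∉class =
    ¬∀⟶∃¬ c _ (λ j → C j u ≟ᴮ C j v) (λ agree → u∉class (∈-colourClass C agree))

  classSize≤largestClass : (C : Cover G c) (v : Fin (n G)) →
    classSize G c C v ≤ largestClass G c C
  classSize≤largestClass C v =
    ∈⇒≤max _ (∈-map⁺ (classSize G c C) (∈-allFin v))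

  repaint : Cover G c → Fin (n G) → Subset (n G) → Cover G c
  repaint C v S j u = if does (u ∈? S) then C j v else C j u

  repaint-inside : ∀ C v S j {u} → u ∈ S → repaint C v S j u ≡ C j v
  repaint-inside C v S j {u} u∈S with u ∈? S
  ... | yes _ = refl
  ... | no u∉S = ⊥-elim (u∉S u∈S)

  repaint-outside : ∀ C v S j {u} → u ∉ S → repaint C v S j u ≡ C j u
  repaint-outside C v S j {u} u∉S with u ∈? S
  ... | yes u∈S = ⊥-elim (u∉S u∈S)
  ... | no _ = refl

  ⊆-colourClass-repaint : ∀ C v S → v ∈ S → S ⊆ colourClass (repaint C v S) v
  ⊆-colourClass-repaint C v S v∈S u∈S =
    ∈-colourClass (repaint C v S)
      (λ j → trans (repaint-inside C v S j u∈S) (sym (repaint-inside C v S j v∈S)))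

  -- A hyperedge containing a vertex u ∉ S and a vertex w ∈ S is
  -- non-monochromatic after repainting, provided S contains the class of
  -- v: some colouring distinguishes u from v, hence from the repainted w.
  repaint-separates : ∀ C v S {e u w} → colourClass C v ⊆ S →
    u ∈ edges G e → u ∉ S → w ∈ edges G e → w ∈ S →
    ∃[ j ] NonMonochromatic G (repaint C v S j) e
  repaint-separates C v S {u = u} {w} class⊆S u∈e u∉S w∈e w∈S
    with j , C[u]≢C[v] ← ∉-colourClass C (λ u∈class → u∉S (class⊆S u∈class))
    = j , u , w , u∈e , w∈e ,
      λ eq → C[u]≢C[v] (trans (sym (repaint-outside C v S j u∉S))
                              (trans eq (repaint-inside C v S j w∈S)))

  -- A separating pair avoiding S still separates; otherwise use
  -- repaint-separates with a vertex of the hyperedge outside S.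
  repaint-isCover : ∀ C v S → IsCover G c C → colourClass C v ⊆ S →
    (∀ e → ∃[ u ] u ∈ edges G e × u ∉ S) → IsCover G c (repaint C v S)
  repaint-isCover C v S cover class⊆S escapes e
    with u , u∈e , u∉S ← escapes e
       | j , w₁ , w₂ , w₁∈e , w₂∈e , C[w₁]≢C[w₂] ← cover e
    with w₁ ∈? S | w₂ ∈? S
  ... | yes w₁∈S | _ = repaint-separates C v S class⊆S u∈e u∉S w₁∈e w₁∈S
  ... | no _ | yes w₂∈S = repaint-separates C v S class⊆S u∈e u∉S w₂∈e w₂∈S
  ... | no w₁∉S | no w₂∉S = j , w₁ , w₂ , w₁∈e , w₂∈e ,
    λ eq → C[w₁]≢C[w₂] (trans (sym (repaint-outside C v S j w₁∉S))
                             (trans eq (repaint-outside C v S j w₂∉S)))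

  module _ {g : ℕ} (γ : IsCoverIndependenceNumber G g) (C : Cover G c)
           (optimal : IsOptimalCover G c C) where

    classSize≤γ : (v : Fin (n G)) → classSize G c C v ≤ g
    classSize≤γ v =
      ≤-trans (classSize≤largestClass C v) (γ .proj₂ c C optimal)

    -- Main lemma: a set S containing the colour class of v and no
    -- hyperedge has at most γ(G) vertices, since repainting S gives an
    -- optimal cover (same size) in which S lies in the class of v.
    noEdgeInside⇒∣S∣≤γ : (v : Fin (n G)) (S : Subset (n G)) →
      colourClass C v ⊆ S → (∀ e → ∃[ u ] u ∈ edges G e × u ∉ S) → ∣ S ∣ ≤ g
    noEdgeInside⇒∣S∣≤γ v S class⊆S escapes =
      ≤-trans (p⊆q⇒∣p∣≤∣q∣ (⊆-colourClass-repaint C v S v∈S))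
        (≤-trans (classSize≤largestClass D v) (γ .proj₂ c D D-optimal))
      where
      v∈S : v ∈ S
      v∈S = class⊆S (∈-colourClass C (λ _ → refl))

      D : Cover G c
      D = repaint C v S

      D-optimal : IsOptimalCover G c D
      D-optimal = repaint-isCover C v S (optimal .proj₁) class⊆S escapes
                , optimal .proj₂

uniform⇒k≤n : ∀ {k} (G : Hypergraph) → Uniform k G → Fin (m G) → k ≤ n G
uniform⇒k≤n G uniform e = subst (_≤ n G) (uniform e) (∣p∣≤n (edges G e))

uniform⇒escapes : ∀ {k} (G : Hypergraph) → Uniform k G → (S : Subset (n G)) →
  ∣ S ∣ < k → ∀ e → ∃[ u ] u ∈ edges G e × u ∉ S
uniform⇒escapes G uniform S ∣S∣<k e =
  larger⇒∃∉ (edges G e) S (subst (∣ S ∣ <_) (sym (uniform e)) ∣S∣<k)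

theorem6 : (k : ℕ) (G : Hypergraph) → Uniform k G → Fin (m G) →
    (g : ℕ) → IsCoverIndependenceNumber G g → k ∸ 1 ≤ g
theorem6 zero G uniform e₀ g γ = z≤n
theorem6 (suc k) G uniform e₀ g γ@((c , C , optimal , _) , _)
  with 1+k≤n ← uniform⇒k≤n G uniform e₀
  with v₀ ← fromℕ< (≤-trans (s≤s z≤n) 1+k≤n)
  with k ≤? classSize G c C v₀
... | yes k≤∣class∣ = ≤-trans k≤∣class∣ (classSize≤γ {G = G} γ C optimal v₀)
... | no k≰∣class∣
  with S , class⊆S , ∣S∣≡k ← ⊆-extend (colourClass {G = G} C v₀) k (<⇒≤ (≰⇒> k≰∣class∣)) (<⇒≤ 1+k≤n)
  = subst (_≤ g) ∣S∣≡k (noEdgeInside⇒∣S∣≤γ {G = G} γ C optimal v₀ S class⊆S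
      (uniform⇒escapes G uniform S (subst (_< suc k) (sym ∣S∣≡k) ≤-refl)))
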